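{- Let $(\mathcal{S},\mathcal{E})$ be a set cover instance with $n=|\mathcal{E}|$ elements, maximal set size $s$, and every element lying in at most $t$ sets. Let $\mathcal{S}_{\mathrm{cvr},1}$ denote the family of sets added to $\mathcal{S}_{\mathrm{cvr}}$ during the first stage ($i=1$) of the base algorithm (described in the context). Then $\mathbb{E}[|\mathcal{S}_{\mathrm{cvr},1}|]=O(n/s)$.
   Context: A set cover instance consists of a universe $\mathcal{E}$ and a family $\mathcal{S}$ of subsets of $\mathcal{E}$ whose union is $\mathcal{E}$. All logarithms are base $2$, and $\log s$, $\log t$ are treated as integers. The base algorithm: start with $\mathcal{S}_{\mathrm{cvr}}=\emptyset$. For stage $i=1,\dots,\log s$, and within each stage for iteration $k=1,\dots,\log t$: for every set $S\in\mathcal{S}$ simultaneously, let $d(S)$ be the number of elements of $S$ not covered by $\mathcal{S}_{\mathrm{cvr}}$ at the beginning of the iteration; if $d(S)\ge s/2^i$, add $S$ to $\mathcal{S}_{\mathrm{cvr}}$ independently with probability $2^k/t$. Finally return $\mathcal{S}_{\mathrm{cvr}}$. -}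

module Defs where

open import Data.Bool using (Bool; true; false; if_then_else_)
open import Data.Nat as ℕ using (ℕ; zero; suc; _≤_; _^_)
open import Data.Nat.Logarithm using (⌈log₂_⌉)
open import Data.Integer using (+_)
open import Data.Rational using (ℚ; 0ℚ; 1ℚ; _+_; _*_; _-_; _⊓_; _/_)
open import Data.Fin using (Fin)
open import Data.Fin.Subset using (Subset; ⊥; _∪_; _∩_; ∁; ∣_∣; ⋃)
open import Data.Vec using (Vec; []; _∷_; lookup; toList; zipWith; tabulate)
open import Data.List using (List; []; _∷_; concatMap; map; foldr)
open import Data.Product using (_×_; _,_; ∃)
open import Data.Sum using (_⊎_)
open import Relation.Binary.PropositionalEquality using (_≡_)

Family : ℕ → ℕ → Set
Family n m = Vec (Subset n) m

Covers : ∀ {n m} → Family n m → Set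
Covers {n} 𝓢 = ∀ (e : Fin n) → ∃ λ j → lookup (lookup 𝓢 j) e ≡ true

IsMaxSetSize : ∀ {n m} → Family n m → ℕ → Set
IsMaxSetSize {n} {m} 𝓢 s =
  (∀ (j : Fin m) → ∣ lookup 𝓢 j ∣ ≤ s) × (m ≡ 0 ⊎ ∃ λ j → ∣ lookup 𝓢 j ∣ ≡ s)

freq : ∀ {n m} → Family n m → Fin n → ℕ
freq 𝓢 e = foldr (λ S acc → if lookup S e then suc acc else acc) 0 (toList 𝓢)

FreqBound : ∀ {n m} → Family n m → ℕ → Set
FreqBound {n} 𝓢 t = ∀ (e : Fin n) → freq 𝓢 e ≤ t

Dist : Set → Set
Dist A = List (ℚ × A)

return : ∀ {A} → A → Dist A
return a = (1ℚ , a) ∷ []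

_>>=_ : ∀ {A B} → Dist A → (A → Dist B) → Dist B
d >>= f = concatMap (λ { (p , a) → map (λ { (q , b) → (p * q , b) }) (f a) }) d

bernoulli : ℚ → Dist Bool
bernoulli p = (p , true) ∷ (1ℚ - p , false) ∷ []

independent : ∀ {A k} → Vec (Dist A) k → Dist (Vec A k)
independent [] = return []
independent (d ∷ ds) = d >>= λ a → independent ds >>= λ as → return (a ∷ as)

𝔼 : ∀ {A} → (A → ℕ) → Dist A → ℚ
𝔼 f d = foldr (λ { (p , a) acc → p * ((+ f a) / 1) + acc }) 0ℚ d

covered : ∀ {n m} → Family n m → Subset m → Subset n
covered 𝓢 C = ⋃ (toList (zipWith (λ S b → if b then S else ⊥) 𝓢 C))

uncov : ∀ {n m} → Family n m → Subset m → Subset n → ℕ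
uncov 𝓢 C S = ∣ S ∩ ∁ (covered 𝓢 C) ∣

-- probability 2^k / t (t = 0 never occurs, since then ⌈log₂ t⌉ = 0 iterations;
-- the cap ⊓ 1 is only relevant when t is not a power of two)
prob : ℕ → ℕ → ℚ
prob k zero = 0ℚ
prob k t@(suc _) = ((+ (2 ^ k)) / t) ⊓ 1ℚ

iteration : ∀ {n m} → Family n m → (s t i k : ℕ) → Subset m → Dist (Subset m)
iteration 𝓢 s t i k C =
  independent (tabulate (λ j →
    if lookup C j then return true
    else (if s ℕ.≤ᵇ 2 ^ i ℕ.* uncov 𝓢 C (lookup 𝓢 j)
          then bernoulli (prob k t) else return false)))

-- run iterations k = from, …, from + r - 1
iterations : ∀ {n m} → Family n m → (s t i : ℕ) → (from r : ℕ) → Subset m → Dist (Subset m)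
iterations 𝓢 s t i from zero C = return C
iterations 𝓢 s t i from (suc r) C =
  iteration 𝓢 s t i from C >>= iterations 𝓢 s t i (suc from) r

stage1 : ∀ {n m} → Family n m → (s t : ℕ) → Dist (Subset m)
stage1 {m = m} 𝓢 s t =
  if 1 ℕ.≤ᵇ ⌈log₂ s ⌉ then iterations 𝓢 s t 1 1 ⌈log₂ t ⌉ ⊥ else return ⊥

module Submission where

-- The proof is a potential argument.  If the next iteration selects candidates with
-- probability p, a family C of chosen sets has potential
--   Φ_p(C) = s·|C| + Σ_{e uncovered by C} (4 + 2p·deg_C(e)),
-- where deg_C(e) counts the candidate sets (eligible, not yet chosen) containing e.
-- A step adds p·#candidates sets in expectation, and since each candidate has at least
-- s/2 uncovered elements, double counting gives s·#candidates ≤ 2·Σ_e deg_C(e).  An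
-- uncovered element survives a step with probability (1-p)^deg, so by Bernoulli's
-- inequality its expected next charge is at most 4 (the next probability being ≤ 2p).
-- Hence Φ does not increase in expectation, and initially Φ ≤ 8n because p·deg ≤ (2/t)·t.

open import Defs
open import Algebra.Bundles using (CommutativeRing; Semiring)
import Algebra.Definitions.RawSemiring as RawSemiringDefs
import Algebra.Properties.Monoid.Sum as MonoidSum
import Algebra.Properties.Semiring.Sum as SemiringSum
open import Data.Bool using (Bool; true; false; if_then_else_; _∧_; _∨_; not)
open import Data.Bool.Properties using (T-≡)
open import Data.Fin using (Fin; zero; suc)
open import Data.Fin.Subset as Subset using (Subset; ∣_∣)
open import Data.Fin.Subset.Properties using (∣⊥∣≡0)
open import Data.Integer as ℤ using (+_)
import Data.Integer.Properties as ℤP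
open import Data.List as List using ([]; _∷_; _++_)
open import Data.List.Relation.Unary.All using (All; []; _∷_)
open import Data.List.Relation.Unary.All.Properties using (++⁺)
open import Data.Nat as ℕ using (ℕ; zero; suc)
open import Data.Nat.Logarithm using (⌈log₂_⌉)
import Data.Nat.Properties as ℕP
open import Data.Product using (∃; _×_; _,_; proj₁; proj₂)
open import Data.Rational as ℚ using (ℚ; 0ℚ; 1ℚ; _+_; _-_; -_; _*_; _/_; _⊓_; _≤_; toℚᵘ; nonNegative)
open import Data.Rational.Properties
open import Data.Rational.Solver using (module +-*-Solver)
import Data.Rational.Unnormalised as U
import Data.Rational.Unnormalised.Properties as UP
open import Data.Sum using (inj₁; inj₂)
open import Data.Vec using (Vec; []; _∷_; lookup; tabulate)
import Data.Vec.Properties as VecP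
open import Function using (_∘_)
open import Function.Bundles using (Equivalence)
open import Level using (0ℓ)
open import Relation.Binary.PropositionalEquality

open +-*-Solver using (solve; _:+_; _:*_; _:-_; _:=_; con)

ι : ℕ → ℚ
ι n = (+ n) / 1

-- A normalised fraction with natural numerator is ≃ to its unnormalised form;
-- this reduces identities between such fractions to integer arithmetic.
frac≃ : ∀ a d → toℚᵘ ((+ a) / suc d) U.≃ U.mkℚᵘ (+ a) d
frac≃ a d = toℚᵘ-fromℚᵘ (U.mkℚᵘ (+ a) d)

ι-+ : ∀ a b → ι (a ℕ.+ b) ≡ ι a + ι b
ι-+ a b = toℚᵘ-injective (begin
  toℚᵘ (ι (a ℕ.+ b))              ≈⟨ frac≃ (a ℕ.+ b) 0 ⟩
  U.mkℚᵘ (+ (a ℕ.+ b)) 0          ≈⟨ U.*≡* integers ⟩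
  U.mkℚᵘ (+ a) 0 U.+ U.mkℚᵘ (+ b) 0 ≈⟨ UP.+-cong (frac≃ a 0) (frac≃ b 0) ⟨
  toℚᵘ (ι a) U.+ toℚᵘ (ι b)       ≈⟨ toℚᵘ-homo-+ (ι a) (ι b) ⟨
  toℚᵘ (ι a + ι b)                ∎)
  where
  open UP.≃-Reasoning
  integers : + (a ℕ.+ b) ℤ.* + 1 ≡ (+ a ℤ.* + 1 ℤ.+ + b ℤ.* + 1) ℤ.* + 1
  integers = cong (ℤ._* + 1) (trans (ℤP.pos-+ a b)
    (sym (cong₂ ℤ._+_ (ℤP.*-identityʳ (+ a)) (ℤP.*-identityʳ (+ b)))))

frac-* : ∀ a b d → (+ (a ℕ.* b)) / suc d ≡ ι a * ((+ b) / suc d)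
frac-* a b d = toℚᵘ-injective (begin
  toℚᵘ ((+ (a ℕ.* b)) / suc d)          ≈⟨ frac≃ (a ℕ.* b) d ⟩
  U.mkℚᵘ (+ (a ℕ.* b)) d                ≈⟨ U.*≡* integers ⟩
  U.mkℚᵘ (+ a) 0 U.* U.mkℚᵘ (+ b) d     ≈⟨ UP.*-cong (frac≃ a 0) (frac≃ b d) ⟨
  toℚᵘ (ι a) U.* toℚᵘ ((+ b) / suc d)   ≈⟨ toℚᵘ-homo-* (ι a) ((+ b) / suc d) ⟨
  toℚᵘ (ι a * ((+ b) / suc d))          ∎)
  where
  open UP.≃-Reasoning
  integers : + (a ℕ.* b) ℤ.* + suc (d ℕ.+ 0) ≡ (+ a ℤ.* + b) ℤ.* + suc d
  integers = cong₂ ℤ._*_ (ℤP.pos-* a b) (cong (λ x → + suc x) (ℕP.+-identityʳ d))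

ι-* : ∀ a b → ι (a ℕ.* b) ≡ ι a * ι b
ι-* a b = frac-* a b 0

frac-cancel : ∀ a d → (+ a) / suc d * ι (suc d) ≡ ι a
frac-cancel a d = toℚᵘ-injective (begin
  toℚᵘ ((+ a) / suc d * ι (suc d))           ≈⟨ toℚᵘ-homo-* ((+ a) / suc d) (ι (suc d)) ⟩
  toℚᵘ ((+ a) / suc d) U.* toℚᵘ (ι (suc d))  ≈⟨ UP.*-cong (frac≃ a d) (frac≃ (suc d) 0) ⟩
  U.mkℚᵘ (+ a) d U.* U.mkℚᵘ (+ suc d) 0       ≈⟨ U.*≡* integers ⟩
  U.mkℚᵘ (+ a) 0                              ≈⟨ frac≃ a 0 ⟨
  toℚᵘ (ι a)                                  ∎)
  where
  open UP.≃-Reasoning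
  integers : (+ a ℤ.* + suc d) ℤ.* + 1 ≡ + a ℤ.* + suc (d ℕ.* 1)
  integers = trans (ℤP.*-identityʳ _) (cong (λ x → + a ℤ.* + suc x) (sym (ℕP.*-identityʳ d)))

ι-nonneg : ∀ a → 0ℚ ≤ ι a
ι-nonneg a = nonNegative⁻¹ (ι a) {{normalize-nonNeg a 1}}

frac-nonneg : ∀ a d → 0ℚ ≤ (+ a) / suc d
frac-nonneg a d = nonNegative⁻¹ ((+ a) / suc d) {{normalize-nonNeg a (suc d)}}

ι-mono : ∀ {a b} → a ℕ.≤ b → ι a ≤ ι b
ι-mono {a} {b} a≤b = begin
  ι a                ≡⟨ +-identityʳ (ι a) ⟨
  ι a + 0ℚ           ≤⟨ +-monoʳ-≤ (ι a) (ι-nonneg (b ℕ.∸ a)) ⟩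
  ι a + ι (b ℕ.∸ a)  ≡⟨ ι-+ a (b ℕ.∸ a) ⟨
  ι (a ℕ.+ (b ℕ.∸ a)) ≡⟨ cong ι (ℕP.m+[n∸m]≡n a≤b) ⟩
  ι b                ∎
  where open ≤-Reasoning

*-monoˡ-nonneg : ∀ {r p q} → 0ℚ ≤ r → p ≤ q → r * p ≤ r * q
*-monoˡ-nonneg {r} 0≤r = *-monoˡ-≤-nonNeg r {{nonNegative 0≤r}}

*-mono-nonneg : ∀ {x y a b} → 0ℚ ≤ x → 0ℚ ≤ a → x ≤ y → a ≤ b → x * a ≤ y * b
*-mono-nonneg {x} {y} {a} {b} 0≤x 0≤a x≤y a≤b = begin
  x * a ≡⟨ *-comm x a ⟩
  a * x ≤⟨ *-monoˡ-nonneg 0≤a x≤y ⟩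
  a * y ≡⟨ *-comm a y ⟩
  y * a ≤⟨ *-monoˡ-nonneg (≤-trans 0≤x x≤y) a≤b ⟩
  y * b ∎
  where open ≤-Reasoning

*-nonneg : ∀ {p q} → 0ℚ ≤ p → 0ℚ ≤ q → 0ℚ ≤ p * q
*-nonneg {p} {q} 0≤p 0≤q = subst (_≤ p * q) (*-zeroʳ p) (*-monoˡ-nonneg 0≤p 0≤q)

+-nonneg : ∀ {p q} → 0ℚ ≤ p → 0ℚ ≤ q → 0ℚ ≤ p + q
+-nonneg = +-mono-≤

1-p-nonneg : ∀ {p} → p ≤ 1ℚ → 0ℚ ≤ 1ℚ - p
1-p-nonneg {p} p≤1 = subst (_≤ 1ℚ - p) (+-inverseʳ p) (+-monoˡ-≤ (- p) p≤1)

𝟙 : Bool → ℕ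
𝟙 true  = 1
𝟙 false = 0

𝟙-∧ : ∀ a b → 𝟙 (a ∧ b) ≡ 𝟙 a ℕ.* 𝟙 b
𝟙-∧ true  b = sym (ℕP.+-identityʳ (𝟙 b))
𝟙-∧ false b = refl

anyᶠ : ∀ {m} → (Fin m → Bool) → Bool
anyᶠ {zero}  f = false
anyᶠ {suc m} f = f zero ∨ anyᶠ (f ∘ suc)

anyᶠ-mono : ∀ {m} (f g : Fin m → Bool) → (∀ j → f j ≡ true → g j ≡ true) →
            anyᶠ f ≡ true → anyᶠ g ≡ true
anyᶠ-mono {suc m} f g f⇒g any-f with f zero in f₀ | g zero in g₀
... | _     | true  = refl
... | true  | false with () ← trans (sym g₀) (f⇒g zero f₀)
... | false | false = anyᶠ-mono (f ∘ suc) (g ∘ suc) (f⇒g ∘ suc) any-f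

anyᶠ-false : ∀ {m} (f : Fin m → Bool) → anyᶠ f ≡ false → ∀ j → f j ≡ false
anyᶠ-false {suc m} f none j with f zero in f₀
anyᶠ-false {suc m} f none zero    | false = f₀
anyᶠ-false {suc m} f none (suc j) | false = anyᶠ-false (f ∘ suc) none j

anyᶠ-none : ∀ {m} (f : Fin m → Bool) → (∀ j → f j ≡ false) → anyᶠ f ≡ false
anyᶠ-none {zero}  f all-false = refl
anyᶠ-none {suc m} f all-false rewrite all-false zero = anyᶠ-none (f ∘ suc) (all-false ∘ suc)

-- Finite sums over ℕ and ℚ, and finite products and powers over ℚ, from the library;
-- ℚΠ provides the monoid-sum lemmas for the multiplicative monoid, i.e. for product.
ℚ-semiring : Semiring 0ℓ 0ℓ
ℚ-semiring = CommutativeRing.semiring +-*-commutativeRing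
module ℕΣ = SemiringSum ℕP.+-*-semiring
module ℚΣ = SemiringSum ℚ-semiring
module ℚΠ = MonoidSum *-1-monoid
open ℕΣ using () renaming (sum to ∑ℕ)
open ℚΣ using () renaming (sum to ∑ℚ)
open RawSemiringDefs ℚ.+-*-rawSemiring using (product; _^_)

∑ℕ-mono : ∀ {m} {f g : Fin m → ℕ} → (∀ j → f j ℕ.≤ g j) → ∑ℕ f ℕ.≤ ∑ℕ g
∑ℕ-mono {zero}  f≤g = ℕ.z≤n
∑ℕ-mono {suc m} f≤g = ℕP.+-mono-≤ (f≤g zero) (∑ℕ-mono (f≤g ∘ suc))

∑ℚ-mono : ∀ {m} {f g : Fin m → ℚ} → (∀ j → f j ≤ g j) → ∑ℚ f ≤ ∑ℚ g
∑ℚ-mono {zero}  f≤g = ≤-refl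
∑ℚ-mono {suc m} f≤g = +-mono-≤ (f≤g zero) (∑ℚ-mono (f≤g ∘ suc))

∑ℚ-nonneg : ∀ {m} {f : Fin m → ℚ} → (∀ j → 0ℚ ≤ f j) → 0ℚ ≤ ∑ℚ f
∑ℚ-nonneg {zero}  0≤f = ≤-refl
∑ℚ-nonneg {suc m} 0≤f = +-nonneg (0≤f zero) (∑ℚ-nonneg (0≤f ∘ suc))

ι-∑ : ∀ {m} (f : Fin m → ℕ) → ι (∑ℕ f) ≡ ∑ℚ (ι ∘ f)
ι-∑ {zero}  f = refl
ι-∑ {suc m} f = trans (ι-+ (f zero) (∑ℕ (f ∘ suc))) (cong (λ x → ι (f zero) + x) (ι-∑ (f ∘ suc)))

∑ℚ-const : ∀ m c → ∑ℚ {m} (λ _ → c) ≡ c * ι m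
∑ℚ-const zero    c = sym (*-zeroʳ c)
∑ℚ-const (suc m) c = begin
  c + ∑ℚ {m} (λ _ → c) ≡⟨ cong (λ x → c + x) (∑ℚ-const m c) ⟩
  c + c * ι m          ≡⟨ cong (_+ c * ι m) (*-identityʳ c) ⟨
  c * 1ℚ + c * ι m     ≡⟨ *-distribˡ-+ c 1ℚ (ι m) ⟨
  c * (1ℚ + ι m)       ≡⟨ cong (c *_) (ι-+ 1 m) ⟨
  c * ι (suc m)        ∎
  where open ≡-Reasoning

product-indicator : ∀ {m} (f : Fin m → Bool) →
  product (λ j → if f j then 0ℚ else 1ℚ) ≡ (if anyᶠ f then 0ℚ else 1ℚ)
product-indicator {zero}  f = refl
product-indicator {suc m} f with f zero
... | true  = *-zeroˡ (product (λ j → if f (suc j) then 0ℚ else 1ℚ))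
... | false = trans (*-identityˡ _) (product-indicator (f ∘ suc))

product-power : ∀ {m} q (b : Fin m → Bool) →
  product (λ j → if b j then q else 1ℚ) ≡ q ^ ∑ℕ (𝟙 ∘ b)
product-power {zero}  q b = refl
product-power {suc m} q b with b zero
... | true  = cong (q *_) (product-power q (b ∘ suc))
... | false = trans (*-identityˡ _) (product-power q (b ∘ suc))

E : ∀ {A : Set} → (A → ℚ) → Dist A → ℚ
E g []            = 0ℚ
E g ((p , a) ∷ d) = p * g a + E g d

mass : ∀ {A : Set} → Dist A → ℚ
mass = E (λ _ → 1ℚ)

𝔼≡E : ∀ {A : Set} (f : A → ℕ) d → 𝔼 f d ≡ E (ι ∘ f) d
𝔼≡E f []            = refl
𝔼≡E f ((p , a) ∷ d) = cong (λ x → p * ι (f a) + x) (𝔼≡E f d)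

E-cong : ∀ {A : Set} {f g : A → ℚ} → (∀ a → f a ≡ g a) → ∀ d → E f d ≡ E g d
E-cong f≡g []            = refl
E-cong f≡g ((p , a) ∷ d) = cong₂ (λ x y → p * x + y) (f≡g a) (E-cong f≡g d)

E-return : ∀ {A : Set} (g : A → ℚ) a → E g (return a) ≡ g a
E-return g a = trans (+-identityʳ _) (*-identityˡ (g a))

E-+ : ∀ {A : Set} (f g : A → ℚ) d → E (λ a → f a + g a) d ≡ E f d + E g d
E-+ f g []            = refl
E-+ f g ((p , a) ∷ d) rewrite E-+ f g d =
  solve 5 (λ p x y u v → p :* (x :+ y) :+ (u :+ v) := (p :* x :+ u) :+ (p :* y :+ v))
    refl p (f a) (g a) (E f d) (E g d)

E-scale : ∀ {A : Set} c (f : A → ℚ) d → E (λ a → c * f a) d ≡ c * E f d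
E-scale c f []            = sym (*-zeroʳ c)
E-scale c f ((p , a) ∷ d) rewrite E-scale c f d =
  solve 4 (λ c p x u → p :* (c :* x) :+ c :* u := c :* (p :* x :+ u)) refl c p (f a) (E f d)

E-const : ∀ {A : Set} c (d : Dist A) → E (λ _ → c) d ≡ c * mass d
E-const c d = trans (E-cong (λ _ → sym (*-identityʳ c)) d) (E-scale c (λ _ → 1ℚ) d)

E-∑ : ∀ {A : Set} {m} (f : Fin m → A → ℚ) d → E (λ a → ∑ℚ (λ j → f j a)) d ≡ ∑ℚ (λ j → E (f j) d)
E-∑ {m = zero}  f d = trans (E-const 0ℚ d) (*-zeroˡ (mass d))
E-∑ {m = suc m} f d = trans (E-+ (f zero) (λ a → ∑ℚ (λ j → f (suc j) a)) d)
  (cong (λ x → E (f zero) d + x) (E-∑ (f ∘ suc) d))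

E-++ : ∀ {A : Set} (g : A → ℚ) xs ys → E g (xs ++ ys) ≡ E g xs + E g ys
E-++ g []            ys = sym (+-identityˡ (E g ys))
E-++ g ((p , a) ∷ xs) ys =
  trans (cong (λ x → p * g a + x) (E-++ g xs ys)) (sym (+-assoc (p * g a) (E g xs) (E g ys)))

-- Rescaling all weights by p rescales the expectation; F is the rescaling map
-- (passed abstractly, since it occurs as an anonymous function inside _>>=_).
E-rescale : ∀ {A : Set} (g : A → ℚ) p (F : ℚ × A → ℚ × A) → (∀ q b → F (q , b) ≡ (p * q , b)) →
            ∀ d → E g (List.map F d) ≡ p * E g d
E-rescale g p F F≡ []            = sym (*-zeroʳ p)
E-rescale g p F F≡ ((q , b) ∷ d) rewrite F≡ q b | E-rescale g p F F≡ d =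
  solve 4 (λ p q x y → (p :* q) :* x :+ p :* y := p :* (q :* x :+ y)) refl p q (g b) (E g d)

E->>= : ∀ {A B : Set} (g : B → ℚ) (d : Dist A) (f : A → Dist B) →
        E g (d >>= f) ≡ E (λ a → E g (f a)) d
E->>= g []            f = refl
E->>= g ((p , a) ∷ d) f =
  trans (E-++ g (List.map _ (f a)) (List.concatMap _ d))
        (cong₂ _+_ (E-rescale g p _ (λ q b → refl) (f a)) (E->>= g d f))

Supported : ∀ {A : Set} → (A → Set) → Dist A → Set
Supported P d = All (λ x → 0ℚ ≤ proj₁ x × P (proj₂ x)) d

supported-return : ∀ {A : Set} {P : A → Set} {a} → P a → Supported P (return a)
supported-return Pa = (ℚ.*≤* (ℤ.+≤+ ℕ.z≤n) , Pa) ∷ []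

supported-rescale : ∀ {A : Set} {P : A → Set} p (F : ℚ × A → ℚ × A) → 0ℚ ≤ p →
                    (∀ q b → F (q , b) ≡ (p * q , b)) → ∀ d → Supported P d → Supported P (List.map F d)
supported-rescale p F 0≤p F≡ []            []                = []
supported-rescale p F 0≤p F≡ ((q , b) ∷ d) ((0≤q , Pb) ∷ Pd) rewrite F≡ q b =
  (*-nonneg 0≤p 0≤q , Pb) ∷ supported-rescale p F 0≤p F≡ d Pd

supported->>= : ∀ {A B : Set} {Q : A → Set} {P : B → Set} (d : Dist A) (f : A → Dist B) →
                Supported Q d → (∀ a → Q a → Supported P (f a)) → Supported P (d >>= f)
supported->>= []            f []                Pf = []
supported->>= ((p , a) ∷ d) f ((0≤p , Qa) ∷ Qd) Pf =
  ++⁺ (supported-rescale p _ 0≤p (λ q b → refl) (f a) (Pf a Qa)) (supported->>= d f Qd Pf)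

E-mono : ∀ {A : Set} {P : A → Set} {f g : A → ℚ} d → Supported P d →
         (∀ a → P a → f a ≤ g a) → E f d ≤ E g d
E-mono []            []               f≤g = ≤-refl
E-mono ((p , a) ∷ d) ((0≤p , Pa) ∷ Pd) f≤g =
  +-mono-≤ (*-monoˡ-nonneg 0≤p (f≤g a Pa)) (E-mono d Pd f≤g)

E-independent-∷ : ∀ {A : Set} {m} (g : Vec A (suc m) → ℚ) d (ds : Vec (Dist A) m) →
  E g (independent (d ∷ ds)) ≡ E (λ a → E (λ as → g (a ∷ as)) (independent ds)) d
E-independent-∷ {A} {m} g d ds = trans (E->>= g d given) (E-cong conditional d)
  where
  given : A → Dist (Vec A (suc m))
  given a = independent ds >>= λ as → return (a ∷ as)
  conditional : ∀ a → E g (given a) ≡ E (λ as → g (a ∷ as)) (independent ds)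
  conditional a = trans (E->>= g (independent ds) (λ as → return (a ∷ as)))
                        (E-cong (λ as → E-return g (a ∷ as)) (independent ds))

E-independent-product : ∀ {A : Set} {m} (ds : Vec (Dist A) m) (h : Fin m → A → ℚ) →
  E (λ v → product (λ j → h j (lookup v j))) (independent ds) ≡ product (λ j → E (h j) (lookup ds j))
E-independent-product []       h = E-return (λ v → product (λ j → h j (lookup v j))) []
E-independent-product {A} {suc m} (d ∷ ds) h = begin
  E (λ v → product (λ j → h j (lookup v j))) (independent (d ∷ ds)) ≡⟨ E-independent-∷ _ d ds ⟩
  E (λ a → E (λ as → h zero a * rest as) (independent ds)) d ≡⟨ E-cong (λ a → E-scale (h zero a) rest (independent ds)) d ⟩
  E (λ a → h zero a * E rest (independent ds)) d              ≡⟨ E-cong (λ a → cong (h zero a *_) IH) d ⟩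
  E (λ a → h zero a * R) d                                    ≡⟨ E-cong (λ a → *-comm (h zero a) R) d ⟩
  E (λ a → R * h zero a) d                                    ≡⟨ E-scale R (h zero) d ⟩
  R * E (h zero) d                                            ≡⟨ *-comm R (E (h zero) d) ⟩
  E (h zero) d * R                                            ∎
  where
  open ≡-Reasoning
  rest : Vec A m → ℚ
  rest as = product (λ j → h (suc j) (lookup as j))
  R : ℚ
  R = product (λ j → E (h (suc j)) (lookup ds j))
  IH : E rest (independent ds) ≡ R
  IH = E-independent-product ds (h ∘ suc)

mass-independent : ∀ {A : Set} {m} (ds : Vec (Dist A) m) → (∀ j → mass (lookup ds j) ≡ 1ℚ) →
                   mass (independent ds) ≡ 1ℚ
mass-independent {m = m} ds mass≡1 = begin
  mass (independent ds)                             ≡⟨ E-cong (λ _ → ℚΠ.sum-replicate-zero m) (independent ds) ⟨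
  E (λ v → product {m} (λ _ → 1ℚ)) (independent ds) ≡⟨ E-independent-product ds (λ _ _ → 1ℚ) ⟩
  product (λ j → mass (lookup ds j))                ≡⟨ ℚΠ.sum-cong-≗ mass≡1 ⟩
  product {m} (λ _ → 1ℚ)                            ≡⟨ ℚΠ.sum-replicate-zero m ⟩
  1ℚ                                                ∎
  where open ≡-Reasoning

E-independent-sum : ∀ {A : Set} {m} (ds : Vec (Dist A) m) (h : Fin m → A → ℚ) →
  (∀ j → mass (lookup ds j) ≡ 1ℚ) →
  E (λ v → ∑ℚ (λ j → h j (lookup v j))) (independent ds) ≡ ∑ℚ (λ j → E (h j) (lookup ds j))
E-independent-sum []       h mass≡1 = E-return (λ v → ∑ℚ (λ j → h j (lookup v j))) []
E-independent-sum {A} {suc m} (d ∷ ds) h mass≡1 = begin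
  E (λ v → ∑ℚ (λ j → h j (lookup v j))) (independent (d ∷ ds)) ≡⟨ E-independent-∷ _ d ds ⟩
  E (λ a → E (λ as → h zero a + rest as) (independent ds)) d ≡⟨ E-cong (λ a → E-+ (λ _ → h zero a) rest (independent ds)) d ⟩
  E (λ a → E (λ _ → h zero a) (independent ds) + E rest (independent ds)) d
       ≡⟨ E-cong (λ a → cong₂ _+_ (trans (E-const (h zero a) (independent ds)) (cong (h zero a *_) tail-mass)) IH) d ⟩
  E (λ a → h zero a * 1ℚ + R) d                              ≡⟨ E-+ (λ a → h zero a * 1ℚ) (λ _ → R) d ⟩
  E (λ a → h zero a * 1ℚ) d + E (λ _ → R) d                  ≡⟨ cong₂ _+_ (E-cong (λ a → *-identityʳ (h zero a)) d) (E-const R d) ⟩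
  E (h zero) d + R * mass d                                  ≡⟨ cong (λ x → E (h zero) d + R * x) (mass≡1 zero) ⟩
  E (h zero) d + R * 1ℚ                                      ≡⟨ cong (λ x → E (h zero) d + x) (*-identityʳ R) ⟩
  E (h zero) d + R                                           ∎
  where
  open ≡-Reasoning
  rest : Vec A m → ℚ
  rest as = ∑ℚ (λ j → h (suc j) (lookup as j))
  R : ℚ
  R = ∑ℚ (λ j → E (h (suc j)) (lookup ds j))
  tail-mass : mass (independent ds) ≡ 1ℚ
  tail-mass = mass-independent ds (mass≡1 ∘ suc)
  IH : E rest (independent ds) ≡ R
  IH = E-independent-sum ds (h ∘ suc) (mass≡1 ∘ suc)

supported-independent : ∀ {A : Set} {m} (ds : Vec (Dist A) m) (R : Fin m → A → Set) →
  (∀ j → Supported (R j) (lookup ds j)) → Supported (λ v → ∀ j → R j (lookup v j)) (independent ds)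
supported-independent []       R supp = supported-return (λ ())
supported-independent (d ∷ ds) R supp =
  supported->>= d _ (supp zero) λ a Ra →
    supported->>= (independent ds) _ (supported-independent ds (R ∘ suc) (supp ∘ suc)) λ as Ras →
      supported-return λ { zero → Ra ; (suc j) → Ras j }

^-nonneg : ∀ {q} → 0ℚ ≤ q → ∀ d → 0ℚ ≤ q ^ d
^-nonneg 0≤q zero    = ι-nonneg 1
^-nonneg 0≤q (suc d) = *-nonneg 0≤q (^-nonneg 0≤q d)

bernoulli-inequality : ∀ {p} → 0ℚ ≤ p → p ≤ 1ℚ → ∀ d → (1ℚ + p * ι d) * (1ℚ - p) ^ d ≤ 1ℚ
bernoulli-inequality {p} 0≤p p≤1 zero =
  ≤-reflexive (solve 1 (λ p → (con 1ℚ :+ p :* con 0ℚ) :* con 1ℚ := con 1ℚ) refl p)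
bernoulli-inequality {p} 0≤p p≤1 (suc d) = begin
  (1ℚ + p * ι (suc d)) * ((1ℚ - p) * a) ≡⟨ cong (λ x → (1ℚ + p * x) * ((1ℚ - p) * a)) (ι-+ 1 d) ⟩
  (1ℚ + p * (1ℚ + y)) * ((1ℚ - p) * a)  ≡⟨ expand ⟩
  (1ℚ + p * y) * a - loss               ≤⟨ +-monoʳ-≤ ((1ℚ + p * y) * a) (neg-antimono-≤ loss-nonneg) ⟩
  (1ℚ + p * y) * a - 0ℚ                 ≡⟨ +-identityʳ _ ⟩
  (1ℚ + p * y) * a                      ≤⟨ bernoulli-inequality 0≤p p≤1 d ⟩
  1ℚ                                    ∎
  where
  open ≤-Reasoning
  a y loss : ℚ
  a = (1ℚ - p) ^ d
  y = ι d
  loss = p * p * (1ℚ + y) * a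
  expand : (1ℚ + p * (1ℚ + y)) * ((1ℚ - p) * a) ≡ (1ℚ + p * y) * a - loss
  expand = solve 3 (λ p y a → (con 1ℚ :+ p :* (con 1ℚ :+ y)) :* ((con 1ℚ :- p) :* a)
                             := (con 1ℚ :+ p :* y) :* a :- p :* p :* (con 1ℚ :+ y) :* a) refl p y a
  loss-nonneg : 0ℚ ≤ loss
  loss-nonneg = *-nonneg (*-nonneg (*-nonneg 0≤p 0≤p) (+-nonneg (ι-nonneg 1) (ι-nonneg d))) (^-nonneg (1-p-nonneg p≤1) d)

prob-nonneg : ∀ k t → 0ℚ ≤ prob k t
prob-nonneg k zero    = ≤-refl
prob-nonneg k (suc t) = ⊓-glb (frac-nonneg (2 ℕ.^ k) t) (ι-nonneg 1)

prob-≤1 : ∀ k t → prob k t ≤ 1ℚ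
prob-≤1 k zero    = ι-nonneg 1
prob-≤1 k (suc t) = p⊓q≤q ((+ (2 ℕ.^ k)) / suc t) 1ℚ

prob-doubling : ∀ k t → prob (suc k) t ≤ ι 2 * prob k t
prob-doubling k zero    = ≤-reflexive (sym (*-zeroʳ (ι 2)))
prob-doubling k (suc t) = cap-doubling {(+ (2 ℕ.^ k)) / suc t} (≤-reflexive (frac-* 2 (2 ℕ.^ k) t))
  where
  cap-doubling : ∀ {x y} → y ≤ ι 2 * x → y ⊓ 1ℚ ≤ ι 2 * (x ⊓ 1ℚ)
  cap-doubling {x} {y} y≤2x with ≤-total x 1ℚ
  ... | inj₁ x≤1 = begin
    y ⊓ 1ℚ         ≤⟨ p⊓q≤p y 1ℚ ⟩
    y              ≤⟨ y≤2x ⟩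
    ι 2 * x        ≡⟨ cong (ι 2 *_) (p≤q⇒p⊓q≡p x≤1) ⟨
    ι 2 * (x ⊓ 1ℚ) ∎
    where open ≤-Reasoning
  ... | inj₂ 1≤x = begin
    y ⊓ 1ℚ         ≤⟨ p⊓q≤q y 1ℚ ⟩
    1ℚ             ≤⟨ ι-mono (ℕ.s≤s (ℕ.z≤n {1})) ⟩
    ι 2            ≡⟨ *-identityʳ (ι 2) ⟨
    ι 2 * 1ℚ       ≡⟨ cong (ι 2 *_) (p≥q⇒p⊓q≡q 1≤x) ⟨
    ι 2 * (x ⊓ 1ℚ) ∎
    where open ≤-Reasoning

prob-first : ∀ t → prob 1 t * ι t ≤ ι 2
prob-first zero    = ι-nonneg 2
prob-first (suc t) = begin
  ((+ 2) / suc t ⊓ 1ℚ) * ι (suc t) ≤⟨ *-monoʳ-≤-nonNeg (ι (suc t)) {{normalize-nonNeg (suc t) 1}} (p⊓q≤p ((+ 2) / suc t) 1ℚ) ⟩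
  (+ 2) / suc t * ι (suc t)        ≡⟨ frac-cancel 2 t ⟩
  ι 2                              ∎
  where open ≤-Reasoning

size-count : ∀ {k} (v : Subset k) → ∣ v ∣ ≡ ∑ℕ (λ i → 𝟙 (lookup v i))
size-count []          = refl
size-count (true ∷ v)  = cong suc (size-count v)
size-count (false ∷ v) = size-count v

freq-count : ∀ {n m} (𝓢 : Family n m) e → freq 𝓢 e ≡ ∑ℕ (λ j → 𝟙 (lookup (lookup 𝓢 j) e))
freq-count []      e = refl
freq-count (S ∷ 𝓢) e with lookup S e
... | true  = cong suc (freq-count 𝓢 e)
... | false = freq-count 𝓢 e

covered-lookup : ∀ {n m} (𝓢 : Family n m) (C : Subset m) e →
  lookup (covered 𝓢 C) e ≡ anyᶠ (λ j → lookup C j ∧ lookup (lookup 𝓢 j) e)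
covered-lookup []      []      e = VecP.lookup-replicate e false
covered-lookup (S ∷ 𝓢) (b ∷ C) e =
  trans (VecP.lookup-zipWith _∨_ e (if b then S else Subset.⊥) (covered 𝓢 C))
        (cong₂ _∨_ (chosen b) (covered-lookup 𝓢 C e))
  where
  chosen : ∀ b → lookup (if b then S else Subset.⊥) e ≡ b ∧ lookup S e
  chosen true  = refl
  chosen false = VecP.lookup-replicate e false

module StageOne {n m : ℕ} (𝓢 : Family n m) (s t : ℕ) where

  mem : Fin m → Fin n → Bool
  mem j e = lookup (lookup 𝓢 j) e

  covers : Subset m → Fin n → Bool
  covers C e = anyᶠ (λ j → lookup C j ∧ mem j e)

  eligible : Subset m → Fin m → Bool
  eligible C j = s ℕ.≤ᵇ 2 ℕ.^ 1 ℕ.* uncov 𝓢 C (lookup 𝓢 j)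

  candidate : Subset m → Fin m → Bool
  candidate C j = not (lookup C j) ∧ eligible C j

  deg : Subset m → Fin n → ℕ
  deg C e = ∑ℕ (λ j → 𝟙 (candidate C j ∧ mem j e))

  _⊑_ : Subset m → Subset m → Set
  C ⊑ C' = ∀ j → lookup C j ≡ true → lookup C' j ≡ true

  uncov-count : ∀ C S → uncov 𝓢 C S ≡ ∑ℕ (λ e → 𝟙 (lookup S e ∧ not (covers C e)))
  uncov-count C S = trans (size-count (S Subset.∩ Subset.∁ (covered 𝓢 C))) (ℕΣ.sum-cong-≗ λ e →
    cong 𝟙 (trans (VecP.lookup-zipWith _∧_ e S (Subset.∁ (covered 𝓢 C)))
      (cong (lookup S e ∧_) (trans (VecP.lookup-map e not (covered 𝓢 C)) (cong not (covered-lookup 𝓢 C e))))))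

  covers-mono : ∀ {C C'} → C ⊑ C' → ∀ e → covers C e ≡ true → covers C' e ≡ true
  covers-mono {C} {C'} C⊑C' e = anyᶠ-mono _ _ chosen-mono
    where
    chosen-mono : ∀ j → lookup C j ∧ mem j e ≡ true → lookup C' j ∧ mem j e ≡ true
    chosen-mono j chosen with lookup C j in Cj
    ... | true rewrite C⊑C' j Cj = chosen

  uncov-antitone : ∀ {C C'} → C ⊑ C' → ∀ S → uncov 𝓢 C' S ℕ.≤ uncov 𝓢 C S
  uncov-antitone {C} {C'} C⊑C' S rewrite uncov-count C S | uncov-count C' S = ∑ℕ-mono pointwise
    where
    pointwise : ∀ e → 𝟙 (lookup S e ∧ not (covers C' e)) ℕ.≤ 𝟙 (lookup S e ∧ not (covers C e))
    pointwise e with covers C e in cov | covers C' e in cov' | lookup S e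
    ... | true  | true  | _     = ℕP.≤-refl
    ... | true  | false | _ with () ← trans (sym cov') (covers-mono {C} {C'} C⊑C' e cov)
    ... | false | _     | false = ℕ.z≤n
    ... | false | true  | true  = ℕ.z≤n
    ... | false | false | true  = ℕP.≤-refl

  eligible⇒ : ∀ {C j} → eligible C j ≡ true → s ℕ.≤ 2 ℕ.* uncov 𝓢 C (lookup 𝓢 j)
  eligible⇒ {C} {j} el = ℕP.≤ᵇ⇒≤ s _ (Equivalence.from T-≡ el)

  eligible-antitone : ∀ {C C'} → C ⊑ C' → ∀ j → eligible C' j ≡ true → eligible C j ≡ true
  eligible-antitone C⊑C' j el = Equivalence.to T-≡ (ℕP.≤⇒≤ᵇ
    (ℕP.≤-trans (eligible⇒ el) (ℕP.*-monoʳ-≤ 2 (uncov-antitone C⊑C' (lookup 𝓢 j)))))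

  deg-antitone : ∀ {C C'} → C ⊑ C' → ∀ e → deg C' e ℕ.≤ deg C e
  deg-antitone {C} {C'} C⊑C' e = ∑ℕ-mono pointwise
    where
    pointwise : ∀ j → 𝟙 (candidate C' j ∧ mem j e) ℕ.≤ 𝟙 (candidate C j ∧ mem j e)
    pointwise j with lookup C' j in C'j | eligible C' j in el' | lookup C j in Cj | eligible C j in el
    ... | true  | _     | _     | _     = ℕ.z≤n
    ... | false | false | _     | _     = ℕ.z≤n
    ... | false | true  | true  | _ with () ← trans (sym C'j) (C⊑C' j Cj)
    ... | false | true  | false | false with () ← trans (sym el) (eligible-antitone C⊑C' j el')
    ... | false | true  | false | true  = ℕP.≤-refl

  -- One iteration from C with selection probability p: chosen sets stay chosen,
  -- candidate sets are added independently with probability p.  Iteration k of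
  -- stage one is, by definition, step (prob k t).
  choice : ℚ → Subset m → Fin m → Dist Bool
  choice p C j = if lookup C j then return true else (if eligible C j then bernoulli p else return false)

  step : ℚ → Subset m → Dist (Subset m)
  step p C = independent (tabulate (choice p C))

  lookup-choices : ∀ p C j → lookup (tabulate (choice p C)) j ≡ choice p C j
  lookup-choices p C = VecP.lookup∘tabulate (choice p C)

  step-mass : ∀ p C j → mass (lookup (tabulate (choice p C)) j) ≡ 1ℚ
  step-mass p C j rewrite lookup-choices p C j with lookup C j | eligible C j
  ... | true  | _     = E-return (λ _ → 1ℚ) true
  ... | false | true  = solve 1 (λ p → p :* con 1ℚ :+ ((con 1ℚ :- p) :* con 1ℚ :+ con 0ℚ) := con 1ℚ) refl p
  ... | false | false = E-return (λ _ → 1ℚ) false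

  step-supported : ∀ p C → 0ℚ ≤ p → p ≤ 1ℚ → Supported (C ⊑_) (step p C)
  step-supported p C 0≤p p≤1 =
    supported-independent (tabulate (choice p C)) (λ j b → lookup C j ≡ true → b ≡ true) coordinate
    where
    coordinate : ∀ j → Supported (λ b → lookup C j ≡ true → b ≡ true) (lookup (tabulate (choice p C)) j)
    coordinate j rewrite lookup-choices p C j with lookup C j
    ... | true = supported-return (λ _ → refl)
    ... | false with eligible C j
    ...   | true  = (0≤p , λ ()) ∷ (1-p-nonneg p≤1 , λ ()) ∷ []
    ...   | false = supported-return (λ ())

  candidates : Subset m → ℕ
  candidates C = ∑ℕ (𝟙 ∘ candidate C)

  E-size : ∀ p C → E (λ C' → ι (∣ C' ∣)) (step p C) ≡ ι (∣ C ∣) + p * ι (candidates C)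
  E-size p C = begin
    E (λ C' → ι (∣ C' ∣)) (step p C)
      ≡⟨ E-cong (λ C' → trans (cong ι (size-count C')) (ι-∑ (λ j → 𝟙 (lookup C' j)))) (step p C) ⟩
    E (λ C' → ∑ℚ (λ j → ι (𝟙 (lookup C' j)))) (step p C)
      ≡⟨ E-independent-sum (tabulate (choice p C)) (λ _ b → ι (𝟙 b)) (step-mass p C) ⟩
    ∑ℚ (λ j → E (ι ∘ 𝟙) (lookup (tabulate (choice p C)) j))
      ≡⟨ ℚΣ.sum-cong-≗ coordinate ⟩
    ∑ℚ (λ j → ι (𝟙 (lookup C j)) + p * ι (𝟙 (candidate C j)))
      ≡⟨ ℚΣ.∑-distrib-+ (λ j → ι (𝟙 (lookup C j))) (λ j → p * ι (𝟙 (candidate C j))) ⟩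
    ∑ℚ (λ j → ι (𝟙 (lookup C j))) + ∑ℚ (λ j → p * ι (𝟙 (candidate C j)))
      ≡⟨ cong₂ _+_ (trans (cong ι (size-count C)) (ι-∑ (𝟙 ∘ lookup C))) (ℚΣ.*-distribˡ-sum p (ι ∘ 𝟙 ∘ candidate C)) ⟨
    ι (∣ C ∣) + p * ∑ℚ (λ j → ι (𝟙 (candidate C j)))
      ≡⟨ cong (λ x → ι (∣ C ∣) + p * x) (ι-∑ (𝟙 ∘ candidate C)) ⟨
    ι (∣ C ∣) + p * ι (candidates C) ∎
    where
    open ≡-Reasoning
    coordinate : ∀ j → E (ι ∘ 𝟙) (lookup (tabulate (choice p C)) j) ≡ ι (𝟙 (lookup C j)) + p * ι (𝟙 (candidate C j))
    coordinate j rewrite lookup-choices p C j with lookup C j | eligible C j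
    ... | true  | _     = solve 1 (λ p → con 1ℚ :* con 1ℚ :+ con 0ℚ := con 1ℚ :+ p :* con 0ℚ) refl p
    ... | false | true  = solve 1 (λ p → p :* con 1ℚ :+ ((con 1ℚ :- p) :* con 0ℚ :+ con 0ℚ) := con 0ℚ :+ p :* con 1ℚ) refl p
    ... | false | false = solve 1 (λ p → con 1ℚ :* con 0ℚ :+ con 0ℚ := con 0ℚ :+ p :* con 0ℚ) refl p

  exposure : Subset m → Fin n → ℕ
  exposure C e = 𝟙 (not (covers C e)) ℕ.* deg C e

  candidate-pays : ∀ C j → s ℕ.* 𝟙 (candidate C j) ℕ.≤ 2 ℕ.* (𝟙 (candidate C j) ℕ.* uncov 𝓢 C (lookup 𝓢 j))
  candidate-pays C j with lookup C j | eligible C j in el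
  ... | true  | _     = ℕP.≤-reflexive (ℕP.*-zeroʳ s)
  ... | false | false = ℕP.≤-reflexive (ℕP.*-zeroʳ s)
  ... | false | true  = subst₂ ℕ._≤_ (sym (ℕP.*-identityʳ s)) (cong (2 ℕ.*_) (sym (ℕP.+-identityʳ (uncov 𝓢 C (lookup 𝓢 j)))))
                                 (eligible⇒ {C} {j} el)

  double-count : ∀ C → ∑ℕ (λ j → 𝟙 (candidate C j) ℕ.* uncov 𝓢 C (lookup 𝓢 j)) ≡ ∑ℕ (exposure C)
  double-count C = begin
    ∑ℕ (λ j → cand j ℕ.* uncov 𝓢 C (lookup 𝓢 j))
      ≡⟨ ℕΣ.sum-cong-≗ (λ j → cong (cand j ℕ.*_) (uncov-count C (lookup 𝓢 j))) ⟩
    ∑ℕ (λ j → cand j ℕ.* ∑ℕ (λ e → 𝟙 (mem j e ∧ uncovered e)))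
      ≡⟨ ℕΣ.sum-cong-≗ (λ j → ℕΣ.*-distribˡ-sum (cand j) (λ e → 𝟙 (mem j e ∧ uncovered e))) ⟩
    ∑ℕ (λ j → ∑ℕ (λ e → cand j ℕ.* 𝟙 (mem j e ∧ uncovered e)))
      ≡⟨ ℕΣ.∑-comm (λ j e → cand j ℕ.* 𝟙 (mem j e ∧ uncovered e)) ⟩
    ∑ℕ (λ e → ∑ℕ (λ j → cand j ℕ.* 𝟙 (mem j e ∧ uncovered e)))
      ≡⟨ ℕΣ.sum-cong-≗ (λ e → ℕΣ.sum-cong-≗ (λ j → incidence j e)) ⟩
    ∑ℕ (λ e → ∑ℕ (λ j → 𝟙 (uncovered e) ℕ.* 𝟙 (candidate C j ∧ mem j e)))
      ≡⟨ ℕΣ.sum-cong-≗ (λ e → ℕΣ.*-distribˡ-sum (𝟙 (uncovered e)) (λ j → 𝟙 (candidate C j ∧ mem j e))) ⟨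
    ∑ℕ (exposure C) ∎
    where
    open ≡-Reasoning
    cand : Fin m → ℕ
    cand j = 𝟙 (candidate C j)
    uncovered : Fin n → Bool
    uncovered e = not (covers C e)
    incidence : ∀ j e → cand j ℕ.* 𝟙 (mem j e ∧ uncovered e) ≡ 𝟙 (uncovered e) ℕ.* 𝟙 (candidate C j ∧ mem j e)
    incidence j e rewrite 𝟙-∧ (mem j e) (uncovered e) | 𝟙-∧ (candidate C j) (mem j e) =
      trans (sym (ℕP.*-assoc (cand j) (𝟙 (mem j e)) (𝟙 (uncovered e))))
            (ℕP.*-comm (cand j ℕ.* 𝟙 (mem j e)) (𝟙 (uncovered e)))

  candidates-charged : ∀ C → s ℕ.* candidates C ℕ.≤ 2 ℕ.* ∑ℕ (exposure C)
  candidates-charged C = begin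
    s ℕ.* candidates C                                             ≡⟨ ℕΣ.*-distribˡ-sum s (𝟙 ∘ candidate C) ⟩
    ∑ℕ (λ j → s ℕ.* 𝟙 (candidate C j))                             ≤⟨ ∑ℕ-mono (candidate-pays C) ⟩
    ∑ℕ (λ j → 2 ℕ.* (𝟙 (candidate C j) ℕ.* uncov 𝓢 C (lookup 𝓢 j))) ≡⟨ ℕΣ.*-distribˡ-sum 2 (λ j → 𝟙 (candidate C j) ℕ.* uncov 𝓢 C (lookup 𝓢 j)) ⟨
    2 ℕ.* ∑ℕ (λ j → 𝟙 (candidate C j) ℕ.* uncov 𝓢 C (lookup 𝓢 j))  ≡⟨ cong (2 ℕ.*_) (double-count C) ⟩
    2 ℕ.* ∑ℕ (exposure C)                                          ∎
    where open ℕP.≤-Reasoning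

  charge : ℚ → Subset m → Fin n → ℚ
  charge p C e = if covers C e then 0ℚ else ι 4 + ι 2 * p * ι (deg C e)

  base : Subset m → Fin n → ℚ
  base C e = if covers C e then 0ℚ else ι 4

  charge-split : ∀ p C e → charge p C e ≡ base C e + p * ι (2 ℕ.* exposure C e)
  charge-split p C e = by-coverage (covers C e)
    where
    open ≡-Reasoning
    by-coverage : ∀ b → (if b then 0ℚ else ι 4 + ι 2 * p * ι (deg C e))
                        ≡ (if b then 0ℚ else ι 4) + p * ι (2 ℕ.* (𝟙 (not b) ℕ.* deg C e))
    by-coverage true  = sym (trans (+-identityˡ (p * 0ℚ)) (*-zeroʳ p))
    by-coverage false = cong (λ x → ι 4 + x) (begin
      ι 2 * p * ι (deg C e)           ≡⟨ solve 3 (λ a p y → a :* p :* y := p :* (a :* y)) refl (ι 2) p (ι (deg C e)) ⟩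
      p * (ι 2 * ι (deg C e))         ≡⟨ cong (p *_) (ι-* 2 (deg C e)) ⟨
      p * ι (2 ℕ.* deg C e)           ≡⟨ cong (λ x → p * ι (2 ℕ.* x)) (ℕP.*-identityˡ (deg C e)) ⟨
      p * ι (2 ℕ.* (1 ℕ.* deg C e))   ∎)

  potential : ℚ → Subset m → ℚ
  potential p C = ι s * ι (∣ C ∣) + ∑ℚ (charge p C)

  misses : Fin n → Fin m → Bool → ℚ
  misses e j b = if b ∧ mem j e then 0ℚ else 1ℚ

  misses-all : ∀ e C' → product (λ j → misses e j (lookup C' j)) ≡ (if covers C' e then 0ℚ else 1ℚ)
  misses-all e C' = product-indicator (λ j → lookup C' j ∧ mem j e)

  E-misses : ∀ p C e → covers C e ≡ false → ∀ j →
    E (misses e j) (lookup (tabulate (choice p C)) j) ≡ (if candidate C j ∧ mem j e then 1ℚ - p else 1ℚ)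
  E-misses p C e uncovered j rewrite lookup-choices p C j
    with lookup C j | eligible C j | mem j e | anyᶠ-false (λ j → lookup C j ∧ mem j e) uncovered j
  ... | true  | _     | true  | ()
  ... | true  | _     | false | _ = E-return (λ b → if b ∧ false then 0ℚ else 1ℚ) true
  ... | false | true  | true  | _ = solve 1 (λ p → p :* con 0ℚ :+ ((con 1ℚ :- p) :* con 1ℚ :+ con 0ℚ) := con 1ℚ :- p) refl p
  ... | false | true  | false | _ = solve 1 (λ p → p :* con 1ℚ :+ ((con 1ℚ :- p) :* con 1ℚ :+ con 0ℚ) := con 1ℚ) refl p
  ... | false | false | c     | _ = E-return (λ b → if b ∧ c then 0ℚ else 1ℚ) false

  E-survives : ∀ p C e → covers C e ≡ false →
    E (λ C' → product (λ j → misses e j (lookup C' j))) (step p C) ≡ (1ℚ - p) ^ deg C e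
  E-survives p C e uncovered = begin
    E (λ C' → product (λ j → misses e j (lookup C' j))) (step p C)
      ≡⟨ E-independent-product (tabulate (choice p C)) (misses e) ⟩
    product (λ j → E (misses e j) (lookup (tabulate (choice p C)) j))
      ≡⟨ ℚΠ.sum-cong-≗ (E-misses p C e uncovered) ⟩
    product (λ j → if candidate C j ∧ mem j e then 1ℚ - p else 1ℚ)
      ≡⟨ product-power (1ℚ - p) (λ j → candidate C j ∧ mem j e) ⟩
    (1ℚ - p) ^ deg C e ∎
    where open ≡-Reasoning

  charge-dominated : ∀ {p p' C C'} e → 0ℚ ≤ p → 0ℚ ≤ p' → p' ≤ ι 2 * p → C ⊑ C' →
    charge p' C' e ≤ ι 4 * (1ℚ + p * ι (deg C e)) * (if covers C' e then 0ℚ else 1ℚ)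
  charge-dominated {p} {p'} {C} {C'} e 0≤p 0≤p' p'≤2p C⊑C' = by-coverage (covers C' e)
    where
    open ≤-Reasoning
    K : ℚ
    K = ι 4 * (1ℚ + p * ι (deg C e))
    by-coverage : ∀ b → (if b then 0ℚ else ι 4 + ι 2 * p' * ι (deg C' e)) ≤ K * (if b then 0ℚ else 1ℚ)
    by-coverage true  = ≤-reflexive (sym (*-zeroʳ K))
    by-coverage false = begin
      ι 4 + ι 2 * p' * ι (deg C' e)
        ≤⟨ +-monoʳ-≤ (ι 4) (*-mono-nonneg (*-nonneg (ι-nonneg 2) 0≤p') (ι-nonneg (deg C' e))
                             (*-monoˡ-nonneg (ι-nonneg 2) p'≤2p) (ι-mono (deg-antitone C⊑C' e))) ⟩
      ι 2 * ι 2 + ι 2 * (ι 2 * p) * ι (deg C e)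
        ≡⟨ solve 3 (λ a p y → a :* a :+ a :* (a :* p) :* y := a :* a :* (con 1ℚ :+ p :* y) :* con 1ℚ)
                   refl (ι 2) p (ι (deg C e)) ⟩
      K * 1ℚ ∎

  E-charge : ∀ p p' C e → 0ℚ ≤ p → p ≤ 1ℚ → 0ℚ ≤ p' → p' ≤ ι 2 * p →
    E (λ C' → charge p' C' e) (step p C) ≤ base C e
  E-charge p p' C e 0≤p p≤1 0≤p' p'≤2p = by-coverage (covers C e) refl
    where
    by-coverage : ∀ b → covers C e ≡ b → E (λ C' → charge p' C' e) (step p C) ≤ (if b then 0ℚ else ι 4)
    by-coverage true covered = begin
      E (λ C' → charge p' C' e) (step p C) ≤⟨ E-mono (step p C) (step-supported p C 0≤p p≤1) stays-covered ⟩
      E (λ _ → 0ℚ) (step p C)               ≡⟨ E-const 0ℚ (step p C) ⟩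
      0ℚ * mass (step p C)                  ≡⟨ *-zeroˡ (mass (step p C)) ⟩
      0ℚ                                    ∎
      where
      open ≤-Reasoning
      stays-covered : ∀ C' → C ⊑ C' → charge p' C' e ≤ 0ℚ
      stays-covered C' C⊑C' = subst (λ b → (if b then 0ℚ else ι 4 + ι 2 * p' * ι (deg C' e)) ≤ 0ℚ)
                                    (sym (covers-mono {C} {C'} C⊑C' e covered)) ≤-refl
    by-coverage false uncovered = begin
      E (λ C' → charge p' C' e) (step p C)
        ≤⟨ E-mono (step p C) (step-supported p C 0≤p p≤1) (λ C' → charge-dominated e 0≤p 0≤p' p'≤2p) ⟩
      E (λ C' → K * (if covers C' e then 0ℚ else 1ℚ)) (step p C)
        ≡⟨ E-cong (λ C' → cong (K *_) (misses-all e C')) (step p C) ⟨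
      E (λ C' → K * product (λ j → misses e j (lookup C' j))) (step p C)
        ≡⟨ E-scale K (λ C' → product (λ j → misses e j (lookup C' j))) (step p C) ⟩
      K * E (λ C' → product (λ j → misses e j (lookup C' j))) (step p C)
        ≡⟨ cong (K *_) (E-survives p C e uncovered) ⟩
      K * (1ℚ - p) ^ deg C e
        ≡⟨ *-assoc (ι 4) (1ℚ + p * ι (deg C e)) ((1ℚ - p) ^ deg C e) ⟩
      ι 4 * ((1ℚ + p * ι (deg C e)) * (1ℚ - p) ^ deg C e)
        ≤⟨ *-monoˡ-nonneg (ι-nonneg 4) (bernoulli-inequality 0≤p p≤1 (deg C e)) ⟩
      ι 4 * 1ℚ
        ≡⟨ *-identityʳ (ι 4) ⟩
      ι 4 ∎
      where
      open ≤-Reasoning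
      K : ℚ
      K = ι 4 * (1ℚ + p * ι (deg C e))

  total-charge : ∀ p C → ∑ℚ (charge p C) ≡ ∑ℚ (base C) + p * ι (2 ℕ.* ∑ℕ (exposure C))
  total-charge p C = begin
    ∑ℚ (charge p C)                                           ≡⟨ ℚΣ.sum-cong-≗ (charge-split p C) ⟩
    ∑ℚ (λ e → base C e + p * ι (2 ℕ.* exposure C e))          ≡⟨ ℚΣ.∑-distrib-+ (base C) (λ e → p * ι (2 ℕ.* exposure C e)) ⟩
    ∑ℚ (base C) + ∑ℚ (λ e → p * ι (2 ℕ.* exposure C e))       ≡⟨ cong (λ x → ∑ℚ (base C) + x) (ℚΣ.*-distribˡ-sum p (λ e → ι (2 ℕ.* exposure C e))) ⟨
    ∑ℚ (base C) + p * ∑ℚ (λ e → ι (2 ℕ.* exposure C e))       ≡⟨ cong (λ x → ∑ℚ (base C) + p * x) (ι-∑ (λ e → 2 ℕ.* exposure C e)) ⟨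
    ∑ℚ (base C) + p * ι (∑ℕ (λ e → 2 ℕ.* exposure C e))       ≡⟨ cong (λ x → ∑ℚ (base C) + p * ι x) (ℕΣ.*-distribˡ-sum 2 (exposure C)) ⟨
    ∑ℚ (base C) + p * ι (2 ℕ.* ∑ℕ (exposure C))               ∎
    where open ≡-Reasoning

  E-cost : ∀ p C → 0ℚ ≤ p →
    E (λ C' → ι s * ι (∣ C' ∣)) (step p C) ≤ ι s * ι (∣ C ∣) + p * ι (2 ℕ.* ∑ℕ (exposure C))
  E-cost p C 0≤p = begin
    E (λ C' → ι s * ι (∣ C' ∣)) (step p C)     ≡⟨ E-scale (ι s) (λ C' → ι (∣ C' ∣)) (step p C) ⟩
    ι s * E (λ C' → ι (∣ C' ∣)) (step p C)     ≡⟨ cong (ι s *_) (E-size p C) ⟩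
    ι s * (ι (∣ C ∣) + p * ι (candidates C))   ≡⟨ solve 4 (λ a b p c → a :* (b :+ p :* c) := a :* b :+ p :* (a :* c)) refl (ι s) (ι (∣ C ∣)) p (ι (candidates C)) ⟩
    ι s * ι (∣ C ∣) + p * (ι s * ι (candidates C)) ≡⟨ cong (λ x → ι s * ι (∣ C ∣) + p * x) (ι-* s (candidates C)) ⟨
    ι s * ι (∣ C ∣) + p * ι (s ℕ.* candidates C)   ≤⟨ +-monoʳ-≤ (ι s * ι (∣ C ∣)) (*-monoˡ-nonneg 0≤p (ι-mono (candidates-charged C))) ⟩
    ι s * ι (∣ C ∣) + p * ι (2 ℕ.* ∑ℕ (exposure C)) ∎
    where open ≤-Reasoning

  potential-step : ∀ p p' C → 0ℚ ≤ p → p ≤ 1ℚ → 0ℚ ≤ p' → p' ≤ ι 2 * p →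
    E (potential p') (step p C) ≤ potential p C
  potential-step p p' C 0≤p p≤1 0≤p' p'≤2p = begin
    E (potential p') (step p C)
      ≡⟨ E-+ (λ C' → ι s * ι (∣ C' ∣)) (λ C' → ∑ℚ (charge p' C')) (step p C) ⟩
    E (λ C' → ι s * ι (∣ C' ∣)) (step p C) + E (λ C' → ∑ℚ (charge p' C')) (step p C)
      ≡⟨ cong (λ x → E (λ C' → ι s * ι (∣ C' ∣)) (step p C) + x) (E-∑ (λ e C' → charge p' C' e) (step p C)) ⟩
    E (λ C' → ι s * ι (∣ C' ∣)) (step p C) + ∑ℚ (λ e → E (λ C' → charge p' C' e) (step p C))
      ≤⟨ +-mono-≤ (E-cost p C 0≤p) (∑ℚ-mono (λ e → E-charge p p' C e 0≤p p≤1 0≤p' p'≤2p)) ⟩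
    (ι s * ι (∣ C ∣) + p * ι (2 ℕ.* ∑ℕ (exposure C))) + ∑ℚ (base C)
      ≡⟨ solve 3 (λ a b c → (a :+ b) :+ c := a :+ (c :+ b)) refl (ι s * ι (∣ C ∣)) (p * ι (2 ℕ.* ∑ℕ (exposure C))) (∑ℚ (base C)) ⟩
    ι s * ι (∣ C ∣) + (∑ℚ (base C) + p * ι (2 ℕ.* ∑ℕ (exposure C)))
      ≡⟨ cong (λ x → ι s * ι (∣ C ∣) + x) (total-charge p C) ⟨
    potential p C ∎
    where open ≤-Reasoning

  charge-nonneg : ∀ p C e → 0ℚ ≤ p → 0ℚ ≤ charge p C e
  charge-nonneg p C e 0≤p = by-coverage (covers C e)
    where
    by-coverage : ∀ b → 0ℚ ≤ (if b then 0ℚ else ι 4 + ι 2 * p * ι (deg C e))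
    by-coverage true  = ≤-refl
    by-coverage false = +-nonneg (ι-nonneg 4) (*-nonneg (*-nonneg (ι-nonneg 2) 0≤p) (ι-nonneg (deg C e)))

  cost≤potential : ∀ p C → 0ℚ ≤ p → ι s * ι (∣ C ∣) ≤ potential p C
  cost≤potential p C 0≤p = begin
    ι s * ι (∣ C ∣)        ≡⟨ +-identityʳ (ι s * ι (∣ C ∣)) ⟨
    ι s * ι (∣ C ∣) + 0ℚ   ≤⟨ +-monoʳ-≤ (ι s * ι (∣ C ∣)) (∑ℚ-nonneg (λ e → charge-nonneg p C e 0≤p)) ⟩
    potential p C          ∎
    where open ≤-Reasoning

  iterations-bound : ∀ r k C →
    E (λ C' → ι s * ι (∣ C' ∣)) (iterations 𝓢 s t 1 k r C) ≤ potential (prob k t) C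
  iterations-bound zero    k C = begin
    E (λ C' → ι s * ι (∣ C' ∣)) (return C) ≡⟨ E-return (λ C' → ι s * ι (∣ C' ∣)) C ⟩
    ι s * ι (∣ C ∣)                        ≤⟨ cost≤potential (prob k t) C (prob-nonneg k t) ⟩
    potential (prob k t) C                 ∎
    where open ≤-Reasoning
  iterations-bound (suc r) k C = begin
    E (λ C' → ι s * ι (∣ C' ∣)) (iterations 𝓢 s t 1 k (suc r) C)
      ≡⟨ E->>= (λ C' → ι s * ι (∣ C' ∣)) (step (prob k t) C) (iterations 𝓢 s t 1 (suc k) r) ⟩
    E (λ C' → E (λ C'' → ι s * ι (∣ C'' ∣)) (iterations 𝓢 s t 1 (suc k) r C')) (step (prob k t) C)
      ≤⟨ E-mono (step (prob k t) C) (step-supported (prob k t) C (prob-nonneg k t) (prob-≤1 k t))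
                (λ C' _ → iterations-bound r (suc k) C') ⟩
    E (potential (prob (suc k) t)) (step (prob k t) C)
      ≤⟨ potential-step (prob k t) (prob (suc k) t) C (prob-nonneg k t) (prob-≤1 k t)
                        (prob-nonneg (suc k) t) (prob-doubling k t) ⟩
    potential (prob k t) C ∎
    where open ≤-Reasoning

  stage1-bound : E (λ C → ι s * ι (∣ C ∣)) (stage1 𝓢 s t) ≤ potential (prob 1 t) Subset.⊥
  stage1-bound = run-or-skip (1 ℕ.≤ᵇ ⌈log₂ s ⌉)
    where
    run-or-skip : ∀ b → E (λ C → ι s * ι (∣ C ∣)) (if b then iterations 𝓢 s t 1 1 ⌈log₂ t ⌉ Subset.⊥ else return Subset.⊥)
                        ≤ potential (prob 1 t) Subset.⊥
    run-or-skip true  = iterations-bound ⌈log₂ t ⌉ 1 Subset.⊥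
    run-or-skip false = iterations-bound 0 1 Subset.⊥

  covers-∅ : ∀ e → covers Subset.⊥ e ≡ false
  covers-∅ e = anyᶠ-none (λ j → lookup (Subset.⊥ {m}) j ∧ mem j e)
                         (λ j → cong (_∧ mem j e) (VecP.lookup-replicate j false))

  deg≤freq : ∀ C e → deg C e ℕ.≤ freq 𝓢 e
  deg≤freq C e = ℕP.≤-trans (∑ℕ-mono (λ j → 𝟙-∧-≤ (candidate C j) (mem j e)))
                            (ℕP.≤-reflexive (sym (freq-count 𝓢 e)))
    where
    𝟙-∧-≤ : ∀ a b → 𝟙 (a ∧ b) ℕ.≤ 𝟙 b
    𝟙-∧-≤ true  b = ℕP.≤-refl
    𝟙-∧-≤ false b = ℕ.z≤n

  -- Initially each charge is at most 4 + 2·(2/t)·t = 8.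
  initial-charge : FreqBound 𝓢 t → ∀ e → charge (prob 1 t) Subset.⊥ e ≤ ι 8
  initial-charge freq≤t e =
    subst (λ b → (if b then 0ℚ else ι 4 + ι 2 * p₁ * ι d) ≤ ι 8) (sym (covers-∅ e)) (begin
      ι 4 + ι 2 * p₁ * ι d    ≡⟨ cong (λ x → ι 4 + x) (*-assoc (ι 2) p₁ (ι d)) ⟩
      ι 4 + ι 2 * (p₁ * ι d)  ≤⟨ +-monoʳ-≤ (ι 4) (*-monoˡ-nonneg (ι-nonneg 2) p₁d≤2) ⟩
      ι 4 + ι 2 * ι 2         ≡⟨⟩
      ι 8                     ∎)
    where
    open ≤-Reasoning
    p₁ : ℚ
    p₁ = prob 1 t
    d : ℕ
    d = deg Subset.⊥ e
    p₁d≤2 : p₁ * ι d ≤ ι 2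
    p₁d≤2 = begin
      p₁ * ι d ≤⟨ *-monoˡ-nonneg (prob-nonneg 1 t) (ι-mono (ℕP.≤-trans (deg≤freq Subset.⊥ e) (freq≤t e))) ⟩
      p₁ * ι t ≤⟨ prob-first t ⟩
      ι 2      ∎

  initial-potential : FreqBound 𝓢 t → potential (prob 1 t) Subset.⊥ ≤ ι 8 * ι n
  initial-potential freq≤t = begin
    ι s * ι (∣ Subset.⊥ {m} ∣) + ∑ℚ (charge p₁ Subset.⊥) ≡⟨ cong (λ k → ι s * ι k + ∑ℚ (charge p₁ Subset.⊥)) (∣⊥∣≡0 m) ⟩
    ι s * 0ℚ + ∑ℚ (charge p₁ Subset.⊥)                   ≡⟨ cong (_+ ∑ℚ (charge p₁ Subset.⊥)) (*-zeroʳ (ι s)) ⟩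
    0ℚ + ∑ℚ (charge p₁ Subset.⊥)                         ≡⟨ +-identityˡ (∑ℚ (charge p₁ Subset.⊥)) ⟩
    ∑ℚ (charge p₁ Subset.⊥)                              ≤⟨ ∑ℚ-mono (initial-charge freq≤t) ⟩
    ∑ℚ {n} (λ _ → ι 8)                                   ≡⟨ ∑ℚ-const n (ι 8) ⟩
    ι 8 * ι n                                            ∎
    where
    open ≤-Reasoning
    p₁ : ℚ
    p₁ = prob 1 t

open StageOne using (stage1-bound; initial-potential)

lemma3p3 : ∃ λ (c : ℕ) → ∀ (n m : ℕ) (𝓢 : Family n m) (s t : ℕ)
    → Covers 𝓢 → IsMaxSetSize 𝓢 s → FreqBound 𝓢 t
    → 𝔼 ∣_∣ (stage1 𝓢 s t) * ((+ s) / 1) ≤ (+ c) / 1 * ((+ n) / 1)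
lemma3p3 = 8 , λ n m 𝓢 s t _ _ freq≤t → begin
  𝔼 ∣_∣ (stage1 𝓢 s t) * ι s                 ≡⟨ cong (_* ι s) (𝔼≡E ∣_∣ (stage1 𝓢 s t)) ⟩
  E (ι ∘ ∣_∣) (stage1 𝓢 s t) * ι s           ≡⟨ *-comm (E (ι ∘ ∣_∣) (stage1 𝓢 s t)) (ι s) ⟩
  ι s * E (ι ∘ ∣_∣) (stage1 𝓢 s t)           ≡⟨ E-scale (ι s) (ι ∘ ∣_∣) (stage1 𝓢 s t) ⟨
  E (λ C → ι s * ι (∣ C ∣)) (stage1 𝓢 s t)   ≤⟨ stage1-bound 𝓢 s t ⟩
  StageOne.potential 𝓢 s t (prob 1 t) Subset.⊥ ≤⟨ initial-potential 𝓢 s t freq≤t ⟩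
  ι 8 * ι n                                  ∎
  where open ≤-Reasoning
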